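{- For any finite signature $\Sigma$ and any formulas $\alpha,\beta$ over $\Sigma$, $[\![\alpha\vee\beta]\!]=[\![(\alpha\to\beta)\to\beta]\!]\cap[\![(\beta\to\alpha)\to\alpha]\!]$. Consequently the set of connectives $\{\bot,\wedge,\to\}$ is complete: every formula over $\Sigma$ has the same denotation as some formula built from atoms of $\Sigma$ using only $\bot,\wedge,\to$.
   Context: $\Sigma$ is a finite set of atoms. Formulas are given by $\alpha ::= \bot \mid p \mid \alpha_1\wedge\alpha_2 \mid \alpha_1\vee\alpha_2 \mid \alpha_1\rightarrow\alpha_2$ with $p\in\Sigma$. A partial interpretation is a map $v:\Sigma\to\{0,1,2\}$; $\mathcal I$ is the set of all of them and $\mathcal I_c$ the set of classical ones (no atom mapped to $1$). The order on $\mathcal I$: $u\le v$ iff for every atom $p$, $u(p)\le v(p)$ and ($u(p)=0$ implies $v(p)=0$). For $S\subseteq\mathcal I$: $\overline S=\mathcal I\setminus S$; $S_c=S\cap\mathcal I_c$; $S\downarrow=\{u\in\mathcal I:\exists v\in S,\ v\ge u\}$ (so $S_c\downarrow=(S_c)\downarrow$). The denotation: $[\![\bot]\!]=\emptyset$; $[\![p]\!]=\{v\in\mathcal I: v(p)=2\}$; $[\![\alpha\wedge\beta]\!]=[\![\alpha]\!]\cap[\![\beta]\!]$; $[\![\alpha\vee\beta]\!]=[\![\alpha]\!]\cup[\![\beta]\!]$; $[\![\alpha\to\beta]\!]=\big(\overline{[\![\alpha]\!]}\cup[\![\beta]\!]\big)\cap\big(\overline{[\![\alpha]\!]}\cup[\![\beta]\!]\big)_c\downarrow$.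 -}

module Defs where

open import Level using (0ℓ)
open import Data.Nat using (ℕ; _≤_)
open import Data.Fin using (Fin)
open import Data.Product using (Σ; _×_; ∃)
open import Relation.Binary.PropositionalEquality using (_≡_)
open import Relation.Nullary using (¬_)
open import Relation.Unary using (Pred; ∅; ∁; _∪_; _∩_)

data V3 : Set where
  v0 v1 v2 : V3

val : V3 → ℕ
val v0 = 0
val v1 = 1
val v2 = 2

Interp : ℕ → Set
Interp n = Fin n → V3

ISet : ℕ → Set₁
ISet n = Pred (Interp n) 0ℓ

_≤I_ : ∀ {n} → Interp n → Interp n → Set
u ≤I v = ∀ p → (val (u p) ≤ val (v p)) × (u p ≡ v0 → v p ≡ v0)

Classical : ∀ {n} → ISet n
Classical v = ∀ p → ¬ (v p ≡ v1)

_c : ∀ {n} → ISet n → ISet n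
S c = S ∩ Classical

_↓ : ∀ {n} → ISet n → ISet n
(S ↓) u = ∃ λ v → S v × (u ≤I v)

infix 30 _c _↓

data Form (n : ℕ) : Set where
  ⊥f   : Form n
  atom : Fin n → Form n
  _∧f_ : Form n → Form n → Form n
  _∨f_ : Form n → Form n → Form n
  _⇒f_ : Form n → Form n → Form n

infixr 6 _∧f_
infixr 5 _∨f_
infixr 4 _⇒f_

⟦_⟧ : ∀ {n} → Form n → ISet n
⟦ ⊥f ⟧ = ∅
⟦ atom p ⟧ v = v p ≡ v2
⟦ α ∧f β ⟧ = ⟦ α ⟧ ∩ ⟦ β ⟧
⟦ α ∨f β ⟧ = ⟦ α ⟧ ∪ ⟦ β ⟧
⟦ α ⇒f β ⟧ = (∁ ⟦ α ⟧ ∪ ⟦ β ⟧) ∩ ((∁ ⟦ α ⟧ ∪ ⟦ β ⟧) c) ↓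

data BotAndImp {n : ℕ} : Form n → Set where
  bai-⊥    : BotAndImp ⊥f
  bai-atom : ∀ p → BotAndImp (atom p)
  bai-∧    : ∀ {α β} → BotAndImp α → BotAndImp β → BotAndImp (α ∧f β)
  bai-⇒    : ∀ {α β} → BotAndImp α → BotAndImp β → BotAndImp (α ⇒f β)

-- The only classical interpretation above v is its classical cover (every 1 raised to 2),
-- so α → β holds at v iff the material implication holds at v and at that cover. A
-- formula is therefore decided by Boolean evaluation at v and at its cover, and its
-- truth persists from v to the cover; on such persistent pairs of truth values the
-- identity for ∨ is a finite truth-table check. Rewriting every ∨ by the double
-- implication then gives an equivalent {⊥, ∧, →}-formula.
module Submission where

open import Defs
open import Data.Bool using (Bool; true; false; T; not; _∧_; _∨_)
open import Data.Bool.Properties using (T-≡; T-∧; T-∨; ⇔→≡)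
open import Data.Nat using (ℕ; _≤_; z≤n; s≤s)
open import Data.Product using (_×_; ∃; _,_)
import Data.Product as Product
open import Data.Product.Function.NonDependent.Propositional using (_×-⇔_)
import Data.Sum as Sum
open import Data.Sum using (_⊎_; inj₁; inj₂; [_,_])
open import Data.Sum.Function.Propositional using (_⊎-⇔_)
open import Data.Unit using (tt)
open import Function using (_∘_)
open import Function.Bundles using (_⇔_; mk⇔; Equivalence)
open import Function.Properties.Equivalence using () renaming (refl to ⇔-refl; sym to ⇔-sym; trans to ⇔-trans)
open import Function.Related.TypeIsomorphisms using (¬-cong-⇔)
open import Relation.Binary.Definitions using (_Respects_)
open import Relation.Binary.PropositionalEquality using (_≡_; _≢_; _≗_; refl; sym; trans; cong; cong₂; subst; module ≡-Reasoning)
open import Relation.Nullary using (¬_)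
open import Relation.Unary using (_∩_; _≐_; ∁; _∪_)

private
  variable
    n : ℕ

raise : V3 → V3
raise v0 = v0
raise v1 = v2
raise v2 = v2

raise-idem : ∀ x → raise (raise x) ≡ raise x
raise-idem v0 = refl
raise-idem v1 = refl
raise-idem v2 = refl

classicalCover : Interp n → Interp n
classicalCover v = raise ∘ v

classicalCover-classical : (v : Interp n) → Classical (classicalCover v)
classicalCover-classical v p = raise-≢v1 (v p)
  where
  raise-≢v1 : ∀ x → raise x ≢ v1
  raise-≢v1 v0 ()
  raise-≢v1 v1 ()
  raise-≢v1 v2 ()

≤I-classicalCover : (v : Interp n) → v ≤I classicalCover v
≤I-classicalCover v p with v p
... | v0 = z≤n , λ _ → refl
... | v1 = s≤s z≤n , λ ()
... | v2 = s≤s (s≤s z≤n) , λ ()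

classical-≥⇒≗classicalCover : {v w : Interp n} → v ≤I w → Classical w → classicalCover v ≗ w
classical-≥⇒≗classicalCover {v = v} {w} v≤w w-classical p
  with v p | w p | v≤w p | w-classical p
... | v0 | v0 | _          | _     = refl
... | v0 | v1 | _ , stays0 | _     with () ← stays0 refl
... | v0 | v2 | _ , stays0 | _     with () ← stays0 refl
... | v1 | v0 | () , _     | _
... | v1 | v1 | _          | not-1 with () ← not-1 refl
... | v1 | v2 | _          | _     = refl
... | v2 | v0 | () , _     | _
... | v2 | v1 | s≤s () , _ | _
... | v2 | v2 | _          | _     = refl

≤I-respˡ-≗ : {u w x : Interp n} → u ≗ w → u ≤I x → w ≤I x
≤I-respˡ-≗ {x = x} u≗w u≤x p =
  subst (λ z → (val z ≤ val (x p)) × (z ≡ v0 → x p ≡ v0)) (u≗w p) (u≤x p)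

⟦⟧-resp-≗ : (α : Form n) → ⟦ α ⟧ Respects _≗_
∁∪-resp-≗ : (α β : Form n) → (∁ ⟦ α ⟧ ∪ ⟦ β ⟧) Respects _≗_

⟦⟧-resp-≗ ⊥f _ ()
⟦⟧-resp-≗ (atom p) u≗w αu = trans (sym (u≗w p)) αu
⟦⟧-resp-≗ (α ∧f β) u≗w = Product.map (⟦⟧-resp-≗ α u≗w) (⟦⟧-resp-≗ β u≗w)
⟦⟧-resp-≗ (α ∨f β) u≗w = Sum.map (⟦⟧-resp-≗ α u≗w) (⟦⟧-resp-≗ β u≗w)
⟦⟧-resp-≗ (α ⇒f β) u≗w =
  Product.map (∁∪-resp-≗ α β u≗w) (Product.map₂ (Product.map₂ (≤I-respˡ-≗ u≗w)))

∁∪-resp-≗ α β u≗w =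
  Sum.map (λ ¬αu αw → ¬αu (⟦⟧-resp-≗ α (sym ∘ u≗w) αw)) (⟦⟧-resp-≗ β u≗w)

c↓⇔classicalCover : {S : ISet n} → S Respects _≗_ → ∀ v → (S c ↓) v ⇔ S (classicalCover v)
c↓⇔classicalCover S-resp v = mk⇔
  (λ (w , (Sw , w-classical) , v≤w) →
     S-resp (sym ∘ classical-≥⇒≗classicalCover v≤w w-classical) Sw)
  (λ Sv↑ → classicalCover v , (Sv↑ , classicalCover-classical v) , ≤I-classicalCover v)

⟦⇒⟧⇔classicalCover : ∀ (α β : Form n) v →
  ⟦ α ⇒f β ⟧ v ⇔ ((∁ ⟦ α ⟧ ∪ ⟦ β ⟧) v × (∁ ⟦ α ⟧ ∪ ⟦ β ⟧) (classicalCover v))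
⟦⇒⟧⇔classicalCover α β v = ⇔-refl ×-⇔ c↓⇔classicalCover (∁∪-resp-≗ α β) v

⟦⟧-persistent : ∀ (α : Form n) v → ⟦ α ⟧ v → ⟦ α ⟧ (classicalCover v)
⟦⟧-persistent ⊥f v ()
⟦⟧-persistent (atom p) v αv = cong raise αv
⟦⟧-persistent (α ∧f β) v = Product.map (⟦⟧-persistent α v) (⟦⟧-persistent β v)
⟦⟧-persistent (α ∨f β) v = Sum.map (⟦⟧-persistent α v) (⟦⟧-persistent β v)
⟦⟧-persistent (α ⇒f β) v α⇒βv =
  Equivalence.from (⟦⇒⟧⇔classicalCover α β (classicalCover v))
    (holds-at-cover , ∁∪-resp-≗ α β (sym ∘ raise-idem ∘ v) holds-at-cover)
  where
  holds-at-cover : (∁ ⟦ α ⟧ ∪ ⟦ β ⟧) (classicalCover v)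
  holds-at-cover = Product.proj₂ (Equivalence.to (⟦⇒⟧⇔classicalCover α β v) α⇒βv)

_⇒ᵇ_ : Bool → Bool → Bool
a ⇒ᵇ b = not a ∨ b

T-⇒ᵇ : ∀ {a b} → T (a ⇒ᵇ b) ⇔ (¬ T a ⊎ T b)
T-⇒ᵇ {true}  {true}  = mk⇔ inj₂ (λ _ → tt)
T-⇒ᵇ {true}  {false} = mk⇔ (λ ()) [ (λ ¬t → ¬t tt) , (λ ()) ]
T-⇒ᵇ {false} {_}     = mk⇔ (λ _ → inj₁ (λ ())) (λ _ → tt)

T-⇔⇒≡ : ∀ {a b} → T a ⇔ T b → a ≡ b
T-⇔⇒≡ Ta⇔Tb = ⇔→≡ (⇔-trans (⇔-sym T-≡) (⇔-trans Ta⇔Tb T-≡))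

-- The value of an implication at v from those of its sides at v (a, b) and at classicalCover v (a′, b′).
implies : (a b a′ b′ : Bool) → Bool
implies a b a′ b′ = (a ⇒ᵇ b) ∧ (a′ ⇒ᵇ b′)

eval : Form n → Interp n → Bool
eval ⊥f       v = false
eval (atom p) v = is2 (v p)
  where
  is2 : V3 → Bool
  is2 v2 = true
  is2 _  = false
eval (α ∧f β) v = eval α v ∧ eval β v
eval (α ∨f β) v = eval α v ∨ eval β v
eval (α ⇒f β) v = implies (eval α v) (eval β v) (eval α (classicalCover v)) (eval β (classicalCover v))

⟦⟧⇔eval : ∀ (α : Form n) v → ⟦ α ⟧ v ⇔ T (eval α v)
⟦⟧⇔eval ⊥f       v = mk⇔ (λ ()) (λ ())
⟦⟧⇔eval (atom p) v with v p
... | v0 = mk⇔ (λ ()) (λ ())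
... | v1 = mk⇔ (λ ()) (λ ())
... | v2 = mk⇔ (λ _ → tt) (λ _ → refl)
⟦⟧⇔eval (α ∧f β) v = ⇔-trans (⟦⟧⇔eval α v ×-⇔ ⟦⟧⇔eval β v) (⇔-sym T-∧)
⟦⟧⇔eval (α ∨f β) v = ⇔-trans (⟦⟧⇔eval α v ⊎-⇔ ⟦⟧⇔eval β v) (⇔-sym T-∨)
⟦⟧⇔eval (α ⇒f β) v =
  ⇔-trans (⟦⇒⟧⇔classicalCover α β v) (⇔-trans (material⇔ v ×-⇔ material⇔ (classicalCover v)) (⇔-sym T-∧))
  where
  material⇔ : ∀ u → (∁ ⟦ α ⟧ ∪ ⟦ β ⟧) u ⇔ T (eval α u ⇒ᵇ eval β u)
  material⇔ u = ⇔-trans (¬-cong-⇔ (⟦⟧⇔eval α u) ⊎-⇔ ⟦⟧⇔eval β u) (⇔-sym T-⇒ᵇ)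

eval-resp-≗ : ∀ (α : Form n) {u w} → u ≗ w → eval α u ≡ eval α w
eval-resp-≗ α {u} {w} u≗w = T-⇔⇒≡
  (⇔-trans (⇔-sym (⟦⟧⇔eval α u))
    (⇔-trans (mk⇔ (⟦⟧-resp-≗ α u≗w) (⟦⟧-resp-≗ α (sym ∘ u≗w))) (⟦⟧⇔eval α w)))

eval-classicalCover-idem : ∀ (α : Form n) v →
  eval α (classicalCover (classicalCover v)) ≡ eval α (classicalCover v)
eval-classicalCover-idem α v = eval-resp-≗ α (raise-idem ∘ v)

eval-persistent : ∀ (α : Form n) v → T (eval α v) → T (eval α (classicalCover v))
eval-persistent α v =
  Equivalence.to (⟦⟧⇔eval α (classicalCover v)) ∘ ⟦⟧-persistent α v ∘ Equivalence.from (⟦⟧⇔eval α v)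

≐-from-eval : ∀ (α β : Form n) → (∀ v → eval α v ≡ eval β v) → ⟦ α ⟧ ≐ ⟦ β ⟧
≐-from-eval α β eval≡ =
  (λ {v} → transport α β v (eval≡ v)) , (λ {v} → transport β α v (sym (eval≡ v)))
  where
  transport : ∀ γ δ v → eval γ v ≡ eval δ v → ⟦ γ ⟧ v → ⟦ δ ⟧ v
  transport γ δ v e = Equivalence.from (⟦⟧⇔eval δ v) ∘ subst T e ∘ Equivalence.to (⟦⟧⇔eval γ v)

∨-via-⇒ : Form n → Form n → Form n
∨-via-⇒ α β = ((α ⇒f β) ⇒f β) ∧f ((β ⇒f α) ⇒f α)

∨≡implies-twice : ∀ {a b a′ b′} → (T a → T a′) → (T b → T b′) →
  a ∨ b ≡ implies (implies a b a′ b′) b (implies a′ b′ a′ b′) b′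
        ∧ implies (implies b a b′ a′) a (implies b′ a′ b′ a′) a′
∨≡implies-twice {true}  {_}     {false} {_}     a→a′ _ with () ← a→a′ tt
∨≡implies-twice {_}     {true}  {_}     {false} _ b→b′ with () ← b→b′ tt
∨≡implies-twice {true}  {true}  {true}  {true}  _ _ = refl
∨≡implies-twice {true}  {false} {true}  {true}  _ _ = refl
∨≡implies-twice {true}  {false} {true}  {false} _ _ = refl
∨≡implies-twice {false} {true}  {true}  {true}  _ _ = refl
∨≡implies-twice {false} {true}  {false} {true}  _ _ = refl
∨≡implies-twice {false} {false} {true}  {true}  _ _ = refl
∨≡implies-twice {false} {false} {true}  {false} _ _ = refl
∨≡implies-twice {false} {false} {false} {true}  _ _ = refl
∨≡implies-twice {false} {false} {false} {false} _ _ = refl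

eval-∨≡∨-via-⇒ : ∀ (α β : Form n) v → eval (α ∨f β) v ≡ eval (∨-via-⇒ α β) v
eval-∨≡∨-via-⇒ α β v
  rewrite eval-classicalCover-idem α v | eval-classicalCover-idem β v
  = ∨≡implies-twice (eval-persistent α v) (eval-persistent β v)

elim∨ : Form n → Form n
elim∨ ⊥f       = ⊥f
elim∨ (atom p) = atom p
elim∨ (α ∧f β) = elim∨ α ∧f elim∨ β
elim∨ (α ∨f β) = ∨-via-⇒ (elim∨ α) (elim∨ β)
elim∨ (α ⇒f β) = elim∨ α ⇒f elim∨ β

elim∨-BotAndImp : (α : Form n) → BotAndImp (elim∨ α)
elim∨-BotAndImp ⊥f       = bai-⊥
elim∨-BotAndImp (atom p) = bai-atom p
elim∨-BotAndImp (α ∧f β) = bai-∧ (elim∨-BotAndImp α) (elim∨-BotAndImp β)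
elim∨-BotAndImp (α ∨f β) = bai-∧ (bai-⇒ (bai-⇒ Bα Bβ) Bβ) (bai-⇒ (bai-⇒ Bβ Bα) Bα)
  where
  Bα = elim∨-BotAndImp α
  Bβ = elim∨-BotAndImp β
elim∨-BotAndImp (α ⇒f β) = bai-⇒ (elim∨-BotAndImp α) (elim∨-BotAndImp β)

eval-elim∨ : ∀ (α : Form n) v → eval (elim∨ α) v ≡ eval α v
eval-elim∨ ⊥f       v = refl
eval-elim∨ (atom p) v = refl
eval-elim∨ (α ∧f β) v = cong₂ _∧_ (eval-elim∨ α v) (eval-elim∨ β v)
eval-elim∨ (α ∨f β) v = begin
  eval (∨-via-⇒ (elim∨ α) (elim∨ β)) v  ≡⟨ eval-∨≡∨-via-⇒ (elim∨ α) (elim∨ β) v ⟨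
  eval (elim∨ α) v ∨ eval (elim∨ β) v   ≡⟨ cong₂ _∨_ (eval-elim∨ α v) (eval-elim∨ β v) ⟩
  eval α v ∨ eval β v                   ∎
  where open ≡-Reasoning
eval-elim∨ (α ⇒f β) v
  rewrite eval-elim∨ α v | eval-elim∨ β v
        | eval-elim∨ α (classicalCover v) | eval-elim∨ β (classicalCover v)
  = refl

theorem3 : (n : ℕ) →
    ((α β : Form n) → ⟦ α ∨f β ⟧ ≐ (⟦ (α ⇒f β) ⇒f β ⟧ ∩ ⟦ (β ⇒f α) ⇒f α ⟧))
    × ((α : Form n) → ∃ λ β → BotAndImp β × (⟦ α ⟧ ≐ ⟦ β ⟧))
theorem3 n =
  (λ α β → ≐-from-eval (α ∨f β) (∨-via-⇒ α β) (eval-∨≡∨-via-⇒ α β)) ,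
  (λ α → elim∨ α , elim∨-BotAndImp α , ≐-from-eval α (elim∨ α) (sym ∘ eval-elim∨ α))
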